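{- Let $k\ge 1$. For all integers $n>1$ and $1\le i,j\le k$, $$B^k_{i,j}(n) = B^k_{i-1,j}(n-1) + B^k_{i,j-1}(n-1) + \sum_{t=2}^{n-1} \binom{n-1}{t-1}\, B^k_{i,k-1}(t-1)\, B^k_{k-1,j}(n-t).$$
   Context: For a permutation $p=(p_1,\dots,p_n)$ of $\{1,\dots,n\}$, a (monotonic) run is a maximal increasing or maximal decreasing subsequence of consecutive entries $p_a,p_{a+1},\dots,p_b$; its length is its number of entries $b-a+1$. For $n\ge2$, the initial run is the run containing $p_1$ and $p_2$; it is decreasing iff $p_1>p_2$, and it is then called the initial decreasing run. The final run is the run containing $p_{n-1}$ and $p_n$; it is increasing iff $p_{n-1}<p_n$, and it is then called the final increasing run. For integers $k\ge1$, $1\le i,j\le k$ and $n\ge 1$, let $B^k_{i,j}(n)$ be the number of permutations of $\{1,\dots,n\}$ all of whose runs have length at most $k$, whose initial decreasing run (if present) has length at most $i$, and whose final increasing run (if present) has length at most $j$. By convention $B^k_{i,j}(1)=1$ for all $1\le i,j\le k$, and $B^k_{i,j}(n)=0$ whenever $i<1$ or $j<1$. -}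

module Defs where

open import Data.Bool using (Bool; true; false; _∧_; if_then_else_)
open import Data.Nat using (ℕ; zero; suc; _+_; _*_; _∸_; _<ᵇ_; _≤ᵇ_; _≟_)
open import Data.Nat.Combinatorics using (_C_)
open import Data.List using (List; []; _∷_; map; concatMap; applyUpTo; length; filterᵇ)
open import Data.Bool.ListAction using (all)
open import Data.Nat.ListAction using (sum)
open import Data.List.Relation.Unary.Unique.Propositional using (Unique)
open import Data.List.Relation.Unary.Unique.DecPropositional _≟_ using (unique?)
open import Data.Product using (_×_; _,_)
open import Relation.Nullary using (does)

words : ℕ → ℕ → List (List ℕ)
words m zero    = [] ∷ []
words m (suc l) = concatMap (λ w → map (_∷ w) (applyUpTo suc m)) (words m l)

isPerm : List ℕ → Bool
isPerm w = does (unique? w)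

perms : ℕ → List (List ℕ)
perms n = filterᵇ isPerm (words n n)

-- Direction between consecutive entries: true = ascent (p_a < p_{a+1}),
-- false = descent.  Length n-1 for a list of length n.
dirs : List ℕ → List Bool
dirs (x ∷ y ∷ r) = (x <ᵇ y) ∷ dirs (y ∷ r)
dirs _           = []

beq : Bool → Bool → Bool
beq true true   = true
beq false false = true
beq _ _         = false

-- Maximal blocks of equal direction, as (direction, number of steps).
-- A block of m equal steps is exactly one (maximal) run with m+1 entries;
-- it is increasing iff the direction is true.
blocks : List Bool → List (Bool × ℕ)
blocks []       = []
blocks (b ∷ bs) with blocks bs
... | []              = (b , 1) ∷ []
... | (c , m) ∷ rest  = if beq b c then (c , suc m) ∷ rest
                        else (b , 1) ∷ (c , m) ∷ rest

runs : List ℕ → List (Bool × ℕ)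
runs p = map (λ { (d , m) → (d , suc m) }) (blocks (dirs p))

lastMaybe : List (Bool × ℕ) → List (Bool × ℕ)
lastMaybe []           = []
lastMaybe (x ∷ [])     = x ∷ []
lastMaybe (x ∷ y ∷ r)  = lastMaybe (y ∷ r)

allRunsOK : ℕ → List ℕ → Bool
allRunsOK k p = all (λ { (_ , len) → len ≤ᵇ k }) (runs p)

initOK : ℕ → List ℕ → Bool
initOK i p with runs p
... | []                 = true
... | (false , len) ∷ _  = len ≤ᵇ i
... | (true , _) ∷ _     = true

finalOK : ℕ → List ℕ → Bool
finalOK j p with lastMaybe (runs p)
... | (true , len) ∷ _   = len ≤ᵇ j
... | _                  = true

good : ℕ → ℕ → ℕ → List ℕ → Bool
good k i j p = allRunsOK k p ∧ initOK i p ∧ finalOK j p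

-- B^k_{i,j}(n), with the conventions B = 0 when i < 1 or j < 1,
-- and B^k_{i,j}(1) = 1 for i, j ≥ 1.
B : ℕ → ℕ → ℕ → ℕ → ℕ
B k zero    j       n       = 0
B k (suc i) zero    n       = 0
B k (suc i) (suc j) (suc zero) = 1
B k (suc i) (suc j) n       = length (filterᵇ (good k (suc i) (suc j)) (perms n))

sumFrom2 : ℕ → (ℕ → ℕ) → ℕ
sumFrom2 n f = sum (map f (applyUpTo (λ m → 2 + m) (n ∸ 2)))

-- The conditions defining B (all runs ≤ k, initial decreasing run ≤ i, final
-- increasing run ≤ j) depend only on the run list of a word, hence only on its
-- sequence of ascents and descents.  Placing the maximum n
--   * in front of a word lengthens the initial descent (i becomes i - 1),
--   * at its end lengthens the final ascent (j becomes j - 1),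
--   * strictly inside creates a peak; the two sides are then independent, the
--     left one with final bound k - 1 and the right one with initial bound k - 1.
-- The file first proves these facts on run lists, then writes B as a sum of
-- indicators over the arrangements of n, …, 1 obtained by successive insertions.
-- Inserting n into all arrangements of the smaller entries gives the three terms;
-- a shuffle identity splits the middle one into a choice of the t - 1 entries
-- left of n and two independent arrangements, which relabelling to 1, …, t - 1
-- and 1, …, n - t identifies with the factors B^k_{i,k-1}(t-1) and B^k_{k-1,j}(n-t).
module Submission where

open import Defs
open import Data.Nat using (ℕ; zero; suc; _+_; _*_; _∸_; _≤_; _<_; _≤ᵇ_; _<ᵇ_; _<?_; _≟_; s≤s; s≤s⁻¹; z≤n)
open import Data.Nat.Properties
open import Data.Nat.Combinatorics using (_C_; nCk+nC[k+1]≡[n+1]C[k+1])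
open import Data.Nat.ListAction using (sum)
open import Data.Bool using (Bool; true; false; _∧_; T; T?; if_then_else_)
open import Data.Bool.Properties using (∧-comm; ∧-assoc; ∧-identityʳ; ∧-zeroʳ; ∧-commutativeMonoid; T-∧; T-≡)
open import Data.Bool.ListAction using (all)
open import Data.Unit using (⊤; tt)
open import Data.Empty using (⊥; ⊥-elim)
open import Data.Product using (Σ; _×_; _,_; proj₁; proj₂; map₁; map₂)
open import Data.Sum using (_⊎_; inj₁; inj₂)
open import Data.List using (List; []; _∷_; _++_; map; concatMap; applyUpTo; applyDownFrom; length; take; drop; filterᵇ)
open import Data.List.Properties using (map-cong; map-cong-local; map-∘; map-applyUpTo; applyUpTo-∷ʳ; take-all; drop-all; length-++; length-map; length-applyDownFrom; ∷-injectiveˡ; ∷-injectiveʳ; reverse-applyUpTo)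
open import Data.List.Relation.Unary.All as All using (All; []; _∷_)
open import Data.List.Relation.Unary.All.Properties using () renaming (map⁺ to All-map⁺; ++⁺ to All-++⁺; take⁺ to All-take⁺; drop⁺ to All-drop⁺; applyUpTo⁺₁ to All-applyUpTo⁺₁; applyDownFrom⁺₁ to All-applyDownFrom⁺₁)
open import Data.List.Relation.Unary.AllPairs using (AllPairs; []; _∷_)
import Data.List.Relation.Unary.AllPairs.Properties as AllPairs
open import Data.List.Relation.Unary.Any using (here; there)
open import Data.List.Relation.Unary.Unique.Propositional using (Unique)
import Data.List.Relation.Unary.Unique.Propositional.Properties as Unique
open import Data.List.Relation.Unary.Unique.DecPropositional _≟_ using (unique?)
open import Data.List.Membership.Propositional using (_∈_)
open import Data.List.Membership.Propositional.Properties using (∈-∃++; ∈-map⁻; ∈-map⁺; ∈-filter⁺; ∈-filter⁻; ∈-concat⁺′; ∈-concat⁻′)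
open import Data.List.Membership.Propositional.Properties.WithK using (unique∧set⇒bag)
open import Data.List.Relation.Binary.BagAndSetEquality using (∼bag⇒↭)
open import Data.List.Relation.Binary.Permutation.Propositional using (_↭_; ↭-refl; ↭-sym; ↭-trans; ↭-prep; ↭-swap; ↭⇒↭ₛ)
open import Data.List.Relation.Binary.Permutation.Propositional.Properties using (∈-resp-↭; All-resp-↭; filter-↭; shift; drop-mid; ↭-length; ↭-empty-inv; ↭-reverse)
import Data.List.Relation.Binary.Permutation.Setoid.Properties as ↭ₛ
open import Algebra.Solver.CommutativeMonoid ∧-commutativeMonoid using (solve; _⊜_; _⊕_)
open import Function.Base using (_∘_)
open import Function.Bundles using (mk⇔; Equivalence)
open import Relation.Binary using (tri<; tri≈; tri>)
open import Relation.Binary.PropositionalEquality using (_≡_; refl; sym; trans; cong; cong₂; subst; setoid; module ≡-Reasoning)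
open import Relation.Nullary using (¬_; yes; no)
open import Relation.Nullary.Decidable using (Dec; does; dec-true; dec-false)

private
  variable
    A A′ : Set

∧-absorbʳ : ∀ {a b} → (T a → T b) → a ∧ b ≡ a
∧-absorbʳ {false} _ = refl
∧-absorbʳ {true} {true} _ = refl
∧-absorbʳ {true} {false} a⇒b = ⊥-elim (a⇒b tt)

∧-absorbˡ : ∀ {a b} → (T b → T a) → a ∧ b ≡ b
∧-absorbˡ {a} {b} b⇒a = trans (∧-comm a b) (∧-absorbʳ b⇒a)

≤ᵇ-suc : ∀ l m → (suc l ≤ᵇ suc m) ≡ (l ≤ᵇ m)
≤ᵇ-suc zero m = refl
≤ᵇ-suc (suc l) m = refl

≤ᵇ-weaken : ∀ {l m n} → m ≤ n → T (l ≤ᵇ m) → T (l ≤ᵇ n)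
≤ᵇ-weaken {l} {m} m≤n l≤m = ≤⇒≤ᵇ (≤-trans (≤ᵇ⇒≤ l m l≤m) m≤n)

-- Nonemptiness, as a proposition that is trivial for visible conses.
NonEmpty : List A → Set
NonEmpty [] = ⊥
NonEmpty (_ ∷ _) = ⊤

-- A run list: (increasing?, number of entries) for each maximal run, left to right.
Runs : Set
Runs = List (Bool × ℕ)

runsOf : List Bool → Runs
runsOf ds = map lengthen (blocks ds)
  where lengthen : Bool × ℕ → Bool × ℕ
        lengthen (d , m) = (d , suc m)

runs-dirs : ∀ p → runs p ≡ runsOf (dirs p)
runs-dirs p = map-cong (λ { (d , m) → refl }) (blocks (dirs p))

consStep : Bool → Runs → Runs
consStep b [] = (b , 2) ∷ []
consStep b ((c , l) ∷ R) = if beq b c then (c , suc l) ∷ R else (b , 2) ∷ (c , l) ∷ R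

runsOf-cons : ∀ b ds → runsOf (b ∷ ds) ≡ consStep b (runsOf ds)
runsOf-cons b ds with blocks ds
... | [] = refl
... | (c , m) ∷ rest with beq b c
...   | true = refl
...   | false = refl

snocAscent : Runs → Runs
snocAscent [] = (true , 2) ∷ []
snocAscent (r ∷ r′ ∷ R) = r ∷ snocAscent (r′ ∷ R)
snocAscent ((true , l) ∷ []) = (true , suc l) ∷ []
snocAscent ((false , l) ∷ []) = (false , l) ∷ (true , 2) ∷ []

snocAscent-nonEmpty : ∀ R → NonEmpty (snocAscent R)
snocAscent-nonEmpty [] = tt
snocAscent-nonEmpty ((true , l) ∷ []) = tt
snocAscent-nonEmpty ((false , l) ∷ []) = tt
snocAscent-nonEmpty (r ∷ r′ ∷ R) = tt

consStep-nonEmpty : ∀ b R → NonEmpty (consStep b R)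
consStep-nonEmpty b [] = tt
consStep-nonEmpty true ((true , l) ∷ R) = tt
consStep-nonEmpty true ((false , l) ∷ R) = tt
consStep-nonEmpty false ((true , l) ∷ R) = tt
consStep-nonEmpty false ((false , l) ∷ R) = tt

consStep-snocAscent : ∀ c R → consStep c (snocAscent R) ≡ snocAscent (consStep c R)
consStep-snocAscent true [] = refl
consStep-snocAscent false [] = refl
consStep-snocAscent true ((true , l) ∷ []) = refl
consStep-snocAscent false ((true , l) ∷ []) = refl
consStep-snocAscent true ((false , l) ∷ []) = refl
consStep-snocAscent false ((false , l) ∷ []) = refl
consStep-snocAscent true ((true , l) ∷ r ∷ R) = refl
consStep-snocAscent false ((true , l) ∷ r ∷ R) = refl
consStep-snocAscent true ((false , l) ∷ r ∷ R) = refl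
consStep-snocAscent false ((false , l) ∷ r ∷ R) = refl

consStep-++ : ∀ c R S → NonEmpty R → consStep c (R ++ S) ≡ consStep c R ++ S
consStep-++ true ((true , l) ∷ R) S _ = refl
consStep-++ true ((false , l) ∷ R) S _ = refl
consStep-++ false ((true , l) ∷ R) S _ = refl
consStep-++ false ((false , l) ∷ R) S _ = refl

runsOf-snoc : ∀ ds → runsOf (ds ++ true ∷ []) ≡ snocAscent (runsOf ds)
runsOf-snoc [] = refl
runsOf-snoc (c ∷ ds) = begin
  runsOf (c ∷ ds ++ true ∷ [])          ≡⟨ runsOf-cons c (ds ++ true ∷ []) ⟩
  consStep c (runsOf (ds ++ true ∷ []))  ≡⟨ cong (consStep c) (runsOf-snoc ds) ⟩
  consStep c (snocAscent (runsOf ds))    ≡⟨ consStep-snocAscent c (runsOf ds) ⟩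
  snocAscent (consStep c (runsOf ds))    ≡⟨ cong snocAscent (runsOf-cons c ds) ⟨
  snocAscent (runsOf (c ∷ ds))           ∎
  where open ≡-Reasoning

runsOf-peak : ∀ ds es → runsOf (ds ++ true ∷ false ∷ es) ≡ snocAscent (runsOf ds) ++ consStep false (runsOf es)
runsOf-peak [] es = begin
  runsOf (true ∷ false ∷ es)                   ≡⟨ runsOf-cons true (false ∷ es) ⟩
  consStep true (runsOf (false ∷ es))          ≡⟨ cong (consStep true) (runsOf-cons false es) ⟩
  consStep true (consStep false (runsOf es))   ≡⟨ ascent-before-descent (runsOf es) ⟩
  (true , 2) ∷ consStep false (runsOf es)      ∎
  where
    open ≡-Reasoning
    ascent-before-descent : ∀ R → consStep true (consStep false R) ≡ (true , 2) ∷ consStep false R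
    ascent-before-descent [] = refl
    ascent-before-descent ((true , l) ∷ R) = refl
    ascent-before-descent ((false , l) ∷ R) = refl
runsOf-peak (c ∷ ds) es = begin
  runsOf (c ∷ ds ++ true ∷ false ∷ es)          ≡⟨ runsOf-cons c (ds ++ true ∷ false ∷ es) ⟩
  consStep c (runsOf (ds ++ true ∷ false ∷ es)) ≡⟨ cong (consStep c) (runsOf-peak ds es) ⟩
  consStep c (snocAscent D ++ E)                ≡⟨ consStep-++ c (snocAscent D) E (snocAscent-nonEmpty D) ⟩
  consStep c (snocAscent D) ++ E                ≡⟨ cong (_++ E) (consStep-snocAscent c D) ⟩
  snocAscent (consStep c D) ++ E                ≡⟨ cong (λ R → snocAscent R ++ E) (runsOf-cons c ds) ⟨
  snocAscent (runsOf (c ∷ ds)) ++ E             ∎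
  where
    open ≡-Reasoning
    D = runsOf ds
    E = consStep false (runsOf es)

Genuine : Runs → Set
Genuine = All (λ r → 2 ≤ proj₂ r)

consStep-genuine : ∀ b R → Genuine R → Genuine (consStep b R)
consStep-genuine b [] _ = s≤s (s≤s z≤n) ∷ []
consStep-genuine true ((true , l) ∷ R) (g ∷ gs) = m≤n⇒m≤1+n g ∷ gs
consStep-genuine true ((false , l) ∷ R) gs = s≤s (s≤s z≤n) ∷ gs
consStep-genuine false ((true , l) ∷ R) gs = s≤s (s≤s z≤n) ∷ gs
consStep-genuine false ((false , l) ∷ R) (g ∷ gs) = m≤n⇒m≤1+n g ∷ gs

runsOf-genuine : ∀ ds → Genuine (runsOf ds)
runsOf-genuine [] = []
runsOf-genuine (b ∷ ds) rewrite runsOf-cons b ds = consStep-genuine b (runsOf ds) (runsOf-genuine ds)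

allAtMost : ℕ → Runs → Bool
allAtMost k [] = true
allAtMost k ((_ , l) ∷ R) = (l ≤ᵇ k) ∧ allAtMost k R

initialAtMost : ℕ → Runs → Bool
initialAtMost i [] = true
initialAtMost i ((false , l) ∷ _) = l ≤ᵇ i
initialAtMost i ((true , _) ∷ _) = true

lastRunAtMost : ℕ → Runs → Bool
lastRunAtMost j ((true , l) ∷ _) = l ≤ᵇ j
lastRunAtMost j _ = true

finalAtMost : ℕ → Runs → Bool
finalAtMost j R = lastRunAtMost j (lastMaybe R)

goodRuns : ℕ → ℕ → ℕ → Runs → Bool
goodRuns k zero j R = false
goodRuns k (suc i) zero R = false
goodRuns k (suc i) (suc j) R = allAtMost k R ∧ initialAtMost (suc i) R ∧ finalAtMost (suc j) R

good-goodRuns : ∀ k i j p → good k (suc i) (suc j) p ≡ goodRuns k (suc i) (suc j) (runsOf (dirs p))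
good-goodRuns k i j p = trans (cong₂ _∧_ (allOK k (runs p)) (cong₂ _∧_ (initOK≡ p) (finalOK≡ p)))
                              (cong (goodRuns k (suc i) (suc j)) (runs-dirs p))
  where
    allOK : ∀ k R → all (λ { (_ , len) → len ≤ᵇ k }) R ≡ allAtMost k R
    allOK k [] = refl
    allOK k ((_ , l) ∷ R) = cong ((l ≤ᵇ k) ∧_) (allOK k R)
    initOK≡ : ∀ p → initOK (suc i) p ≡ initialAtMost (suc i) (runs p)
    initOK≡ p with runs p
    ... | [] = refl
    ... | (false , _) ∷ _ = refl
    ... | (true , _) ∷ _ = refl
    finalOK≡ : ∀ p → finalOK (suc j) p ≡ finalAtMost (suc j) (runs p)
    finalOK≡ p with lastMaybe (runs p)
    ... | [] = refl
    ... | (false , _) ∷ _ = refl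
    ... | (true , _) ∷ _ = refl

allAtMost-++ : ∀ k R S → allAtMost k (R ++ S) ≡ allAtMost k R ∧ allAtMost k S
allAtMost-++ k [] S = refl
allAtMost-++ k ((_ , l) ∷ R) S = trans (cong ((l ≤ᵇ k) ∧_) (allAtMost-++ k R S)) (sym (∧-assoc (l ≤ᵇ k) _ _))

initialAtMost-++ : ∀ i R S → NonEmpty R → initialAtMost i (R ++ S) ≡ initialAtMost i R
initialAtMost-++ i ((true , l) ∷ R) S _ = refl
initialAtMost-++ i ((false , l) ∷ R) S _ = refl

finalAtMost-++ : ∀ j R S → NonEmpty S → finalAtMost j (R ++ S) ≡ finalAtMost j S
finalAtMost-++ j [] S _ = refl
finalAtMost-++ j (r ∷ []) (s ∷ S) _ = refl
finalAtMost-++ j (r ∷ r′ ∷ R) S ne = finalAtMost-++ j (r′ ∷ R) S ne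

allAtMost⇒initialAtMost : ∀ k R → T (allAtMost k R) → T (initialAtMost k R)
allAtMost⇒initialAtMost k [] _ = tt
allAtMost⇒initialAtMost k ((true , l) ∷ R) _ = tt
allAtMost⇒initialAtMost k ((false , l) ∷ R) t = proj₁ (Equivalence.to T-∧ t)

allAtMost⇒finalAtMost : ∀ k R → T (allAtMost k R) → T (finalAtMost k R)
allAtMost⇒finalAtMost k [] _ = tt
allAtMost⇒finalAtMost k ((true , l) ∷ []) t = proj₁ (Equivalence.to T-∧ t)
allAtMost⇒finalAtMost k ((false , l) ∷ []) _ = tt
allAtMost⇒finalAtMost k (r ∷ r′ ∷ R) t = allAtMost⇒finalAtMost k (r′ ∷ R) (proj₂ (Equivalence.to (T-∧ {proj₂ r ≤ᵇ k}) t))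

goodRuns-split : ∀ k i j X Y → NonEmpty X → NonEmpty Y →
  goodRuns (suc k) (suc i) (suc j) (X ++ Y) ≡
  goodRuns (suc k) (suc i) (suc k) X ∧ goodRuns (suc k) (suc k) (suc j) Y
goodRuns-split k i j X Y neX neY = begin
  allAtMost K (X ++ Y) ∧ initialAtMost I (X ++ Y) ∧ finalAtMost J (X ++ Y)
    ≡⟨ cong₂ _∧_ (allAtMost-++ K X Y) (cong₂ _∧_ (initialAtMost-++ I X Y neX) (finalAtMost-++ J X Y neY)) ⟩
  (aX ∧ aY) ∧ iX ∧ fY
    ≡⟨ cong₂ (λ a b → (a ∧ b) ∧ iX ∧ fY) (∧-absorbʳ (allAtMost⇒finalAtMost K X)) (∧-absorbʳ (allAtMost⇒initialAtMost K Y)) ⟨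
  ((aX ∧ fX) ∧ (aY ∧ iY)) ∧ iX ∧ fY
    ≡⟨ solve 6 (λ aX aY iX iY fX fY → ((aX ⊕ fX) ⊕ (aY ⊕ iY)) ⊕ (iX ⊕ fY) ⊜ (aX ⊕ (iX ⊕ fX)) ⊕ (aY ⊕ (iY ⊕ fY))) refl aX aY iX iY fX fY ⟩
  (aX ∧ iX ∧ fX) ∧ (aY ∧ iY ∧ fY) ∎
  where
    open ≡-Reasoning
    K = suc k
    I = suc i
    J = suc j
    aX = allAtMost K X
    aY = allAtMost K Y
    iX = initialAtMost I X
    iY = initialAtMost K Y
    fX = finalAtMost K X
    fY = finalAtMost J Y

-- Lengthening a one-run word by one entry uses up one unit of its bound.
lengthen-bound : ∀ k i l → i ≤ k →
  ((suc l ≤ᵇ suc (suc k)) ∧ true) ∧ (suc l ≤ᵇ suc (suc i)) ≡ ((l ≤ᵇ suc (suc k)) ∧ true) ∧ (l ≤ᵇ suc i)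
lengthen-bound k i l i≤k = begin
  ((suc l ≤ᵇ suc (suc k)) ∧ true) ∧ (suc l ≤ᵇ suc (suc i))
    ≡⟨ cong₂ (λ a b → (a ∧ true) ∧ b) (≤ᵇ-suc l (suc k)) (≤ᵇ-suc l (suc i)) ⟩
  ((l ≤ᵇ suc k) ∧ true) ∧ (l ≤ᵇ suc i)
    ≡⟨ cong (_∧ (l ≤ᵇ suc i)) (∧-identityʳ (l ≤ᵇ suc k)) ⟩
  (l ≤ᵇ suc k) ∧ (l ≤ᵇ suc i)
    ≡⟨ ∧-absorbˡ (≤ᵇ-weaken {l} (s≤s i≤k)) ⟩
  l ≤ᵇ suc i
    ≡⟨ ∧-absorbˡ (≤ᵇ-weaken {l} (m≤n⇒m≤1+n (s≤s i≤k))) ⟨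
  (l ≤ᵇ suc (suc k)) ∧ (l ≤ᵇ suc i)
    ≡⟨ cong (_∧ (l ≤ᵇ suc i)) (∧-identityʳ (l ≤ᵇ suc (suc k))) ⟨
  ((l ≤ᵇ suc (suc k)) ∧ true) ∧ (l ≤ᵇ suc i) ∎
  where open ≡-Reasoning

-- Prepending a descent: the new first run is decreasing with at least two
-- entries, so it consumes one unit of the initial bound i (which must be ≤ k).
goodRuns-consDescent : ∀ k i j Y → i ≤ k → Genuine Y →
  goodRuns k i j (consStep false Y) ≡ goodRuns k (i ∸ 1) j Y
goodRuns-consDescent k zero j Y _ _ = refl
goodRuns-consDescent k (suc zero) zero Y _ _ = refl
goodRuns-consDescent k (suc zero) (suc j) Y _ gY =
  trans (cong (λ b → allAtMost k (consStep false Y) ∧ b ∧ finalAtMost (suc j) (consStep false Y)) (initial-one Y gY))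
        (∧-zeroʳ _)
  where
    initial-one : ∀ Y → Genuine Y → initialAtMost 1 (consStep false Y) ≡ false
    initial-one [] _ = refl
    initial-one ((true , l) ∷ R) _ = refl
    initial-one ((false , _) ∷ R) (s≤s (s≤s _) ∷ _) = refl
goodRuns-consDescent k (suc (suc i)) zero Y _ _ = refl
goodRuns-consDescent (suc (suc k)) (suc (suc i)) (suc j) Y (s≤s (s≤s i≤k)) gY = shape Y
  where
    K = suc (suc k)
    single : ∀ j l → goodRuns K (suc (suc i)) (suc j) ((false , suc l) ∷ []) ≡ goodRuns K (suc i) (suc j) ((false , l) ∷ [])
    single j l =
      trans (cong (((suc l ≤ᵇ K) ∧ true) ∧_) (∧-identityʳ (suc l ≤ᵇ suc (suc i))))
            (trans (lengthen-bound k i l i≤k) (cong (((l ≤ᵇ K) ∧ true) ∧_) (sym (∧-identityʳ (l ≤ᵇ suc i)))))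
    -- Only the first run changes; beyond a single run, goodRuns-split isolates it.
    shape : ∀ Y → goodRuns K (suc (suc i)) (suc j) (consStep false Y) ≡ goodRuns K (suc i) (suc j) Y
    shape [] = refl
    shape ((true , l) ∷ R) = refl
    shape ((false , l) ∷ []) = single j l
    shape ((false , l) ∷ r ∷ R) = begin
      goodRuns K (suc (suc i)) (suc j) (((false , suc l) ∷ []) ++ r ∷ R)
        ≡⟨ goodRuns-split (suc k) (suc i) j ((false , suc l) ∷ []) (r ∷ R) tt tt ⟩
      goodRuns K (suc (suc i)) K ((false , suc l) ∷ []) ∧ goodRuns K K (suc j) (r ∷ R)
        ≡⟨ cong (_∧ goodRuns K K (suc j) (r ∷ R)) (single (suc k) l) ⟩
      goodRuns K (suc i) K ((false , l) ∷ []) ∧ goodRuns K K (suc j) (r ∷ R)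
        ≡⟨ goodRuns-split (suc k) i j ((false , l) ∷ []) (r ∷ R) tt tt ⟨
      goodRuns K (suc i) (suc j) (((false , l) ∷ []) ++ r ∷ R) ∎
      where open ≡-Reasoning

-- Appending an ascent: the new last run is increasing with at least two
-- entries, so it consumes one unit of the final bound j (which must be ≤ k).
goodRuns-snocAscent : ∀ k i j X → j ≤ k → Genuine X →
  goodRuns k i j (snocAscent X) ≡ goodRuns k i (j ∸ 1) X
goodRuns-snocAscent k zero j X _ _ = refl
goodRuns-snocAscent k (suc i) zero X _ _ = refl
goodRuns-snocAscent k (suc i) (suc zero) X _ gX =
  trans (cong (allAtMost k (snocAscent X) ∧_) (trans (cong (initialAtMost (suc i) (snocAscent X) ∧_) (final-one X gX)) (∧-zeroʳ _)))
        (∧-zeroʳ _)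
  where
    final-one : ∀ X → Genuine X → finalAtMost 1 (snocAscent X) ≡ false
    final-one [] _ = refl
    final-one (r ∷ r′ ∷ R) (_ ∷ gR) =
      trans (finalAtMost-++ 1 (r ∷ []) (snocAscent (r′ ∷ R)) (snocAscent-nonEmpty (r′ ∷ R))) (final-one (r′ ∷ R) gR)
    final-one ((true , _) ∷ []) (s≤s (s≤s _) ∷ _) = refl
    final-one ((false , _) ∷ []) _ = refl
goodRuns-snocAscent (suc (suc k)) (suc i) (suc (suc j)) X (s≤s (s≤s j≤k)) gX = shape X gX
  where
    K = suc (suc k)
    -- Only the last run changes; goodRuns-split peels off the runs before it.
    shape : ∀ X → Genuine X → goodRuns K (suc i) (suc (suc j)) (snocAscent X) ≡ goodRuns K (suc i) (suc j) X
    shape [] _ = refl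
    shape ((true , l) ∷ []) _ = lengthen-bound k j l j≤k
    shape ((false , l) ∷ []) _ = refl
    shape (r ∷ r′ ∷ R) (_ ∷ gR) = begin
      goodRuns K (suc i) (suc (suc j)) ((r ∷ []) ++ snocAscent (r′ ∷ R))
        ≡⟨ goodRuns-split (suc k) i (suc j) (r ∷ []) (snocAscent (r′ ∷ R)) tt (snocAscent-nonEmpty (r′ ∷ R)) ⟩
      goodRuns K (suc i) K (r ∷ []) ∧ goodRuns K K (suc (suc j)) (snocAscent (r′ ∷ R))
        ≡⟨ cong (goodRuns K (suc i) K (r ∷ []) ∧_) (goodRuns-snocAscent K K (suc (suc j)) (r′ ∷ R) (s≤s (s≤s j≤k)) gR) ⟩
      goodRuns K (suc i) K (r ∷ []) ∧ goodRuns K K (suc j) (r′ ∷ R)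
        ≡⟨ goodRuns-split (suc k) i j (r ∷ []) (r′ ∷ R) tt tt ⟨
      goodRuns K (suc i) (suc j) ((r ∷ []) ++ r′ ∷ R) ∎
      where open ≡-Reasoning

goodRuns-peak : ∀ k i j X Y → Genuine X → Genuine Y →
  goodRuns (suc k) i j (snocAscent X ++ consStep false Y) ≡ goodRuns (suc k) i k X ∧ goodRuns (suc k) k j Y
goodRuns-peak k zero j X Y _ _ = refl
goodRuns-peak zero (suc i) zero X Y _ _ = refl
goodRuns-peak (suc k) (suc i) zero X Y _ _ = sym (∧-zeroʳ _)
goodRuns-peak k (suc i) (suc j) X Y gX gY = begin
  goodRuns (suc k) (suc i) (suc j) (snocAscent X ++ consStep false Y)
    ≡⟨ goodRuns-split k i j (snocAscent X) (consStep false Y) (snocAscent-nonEmpty X) (consStep-nonEmpty false Y) ⟩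
  goodRuns (suc k) (suc i) (suc k) (snocAscent X) ∧ goodRuns (suc k) (suc k) (suc j) (consStep false Y)
    ≡⟨ cong₂ _∧_ (goodRuns-snocAscent (suc k) (suc i) (suc k) X ≤-refl gX) (goodRuns-consDescent (suc k) (suc k) (suc j) Y ≤-refl gY) ⟩
  goodRuns (suc k) (suc i) k X ∧ goodRuns (suc k) k (suc j) Y ∎
  where open ≡-Reasoning

sumBy : (A → ℕ) → List A → ℕ
sumBy f [] = 0
sumBy f (x ∷ xs) = f x + sumBy f xs

sumBy-++ : ∀ (f : A → ℕ) xs ys → sumBy f (xs ++ ys) ≡ sumBy f xs + sumBy f ys
sumBy-++ f [] ys = refl
sumBy-++ f (x ∷ xs) ys = trans (cong (f x +_) (sumBy-++ f xs ys)) (sym (+-assoc (f x) _ _))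

sumBy-map : ∀ (f : A′ → ℕ) (g : A → A′) xs → sumBy f (map g xs) ≡ sumBy (λ x → f (g x)) xs
sumBy-map f g [] = refl
sumBy-map f g (x ∷ xs) = cong (f (g x) +_) (sumBy-map f g xs)

sumBy-concatMap : ∀ (f : A′ → ℕ) (g : A → List A′) xs →
  sumBy f (concatMap g xs) ≡ sumBy (λ x → sumBy f (g x)) xs
sumBy-concatMap f g [] = refl
sumBy-concatMap f g (x ∷ xs) = trans (sumBy-++ f (g x) (concatMap g xs)) (cong (sumBy f (g x) +_) (sumBy-concatMap f g xs))

sumBy-congᴬ : ∀ {f g : A → ℕ} {xs} → All (λ x → f x ≡ g x) xs → sumBy f xs ≡ sumBy g xs
sumBy-congᴬ [] = refl
sumBy-congᴬ (e ∷ es) = cong₂ _+_ e (sumBy-congᴬ es)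

sumBy-cong : ∀ {f g : A → ℕ} → (∀ x → f x ≡ g x) → ∀ xs → sumBy f xs ≡ sumBy g xs
sumBy-cong e [] = refl
sumBy-cong e (x ∷ xs) = cong₂ _+_ (e x) (sumBy-cong e xs)

sumBy-+ : ∀ (f g : A → ℕ) xs → sumBy (λ x → f x + g x) xs ≡ sumBy f xs + sumBy g xs
sumBy-+ f g [] = refl
sumBy-+ f g (x ∷ xs) = begin
  (f x + g x) + sumBy (λ x → f x + g x) xs ≡⟨ cong ((f x + g x) +_) (sumBy-+ f g xs) ⟩
  (f x + g x) + (sumBy f xs + sumBy g xs) ≡⟨ +-assoc (f x) (g x) _ ⟩
  f x + (g x + (sumBy f xs + sumBy g xs)) ≡⟨ cong (f x +_) (+-comm (g x) _) ⟩
  f x + ((sumBy f xs + sumBy g xs) + g x) ≡⟨ cong (f x +_) (+-assoc (sumBy f xs) _ _) ⟩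
  f x + (sumBy f xs + (sumBy g xs + g x)) ≡⟨ cong (λ z → f x + (sumBy f xs + z)) (+-comm (sumBy g xs) (g x)) ⟩
  f x + (sumBy f xs + (g x + sumBy g xs)) ≡⟨ +-assoc (f x) _ _ ⟨
  (f x + sumBy f xs) + (g x + sumBy g xs) ∎
  where open ≡-Reasoning

sumBy-*ˡ : ∀ c (f : A → ℕ) xs → sumBy (λ x → c * f x) xs ≡ c * sumBy f xs
sumBy-*ˡ c f [] = sym (*-zeroʳ c)
sumBy-*ˡ c f (x ∷ xs) = trans (cong (c * f x +_) (sumBy-*ˡ c f xs)) (sym (*-distribˡ-+ c (f x) _))

sumBy-*ʳ : ∀ c (f : A → ℕ) xs → sumBy (λ x → f x * c) xs ≡ sumBy f xs * c
sumBy-*ʳ c f [] = refl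
sumBy-*ʳ c f (x ∷ xs) = trans (cong (f x * c +_) (sumBy-*ʳ c f xs)) (sym (*-distribʳ-+ c (f x) _))

sumBy-zero : ∀ (xs : List A) → sumBy (λ _ → 0) xs ≡ 0
sumBy-zero [] = refl
sumBy-zero (_ ∷ xs) = sumBy-zero xs

sumBy-const : ∀ {f : A → ℕ} {c} xs → All (λ x → f x ≡ c) xs → sumBy f xs ≡ length xs * c
sumBy-const [] [] = refl
sumBy-const (x ∷ xs) (e ∷ es) = cong₂ _+_ e (sumBy-const xs es)

sumBy-swap : ∀ (F : A → A′ → ℕ) xs ys →
  sumBy (λ x → sumBy (F x) ys) xs ≡ sumBy (λ y → sumBy (λ x → F x y) xs) ys
sumBy-swap F [] ys = sym (sumBy-zero ys)
sumBy-swap F (x ∷ xs) ys =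
  trans (cong (sumBy (F x) ys +_) (sumBy-swap F xs ys)) (sym (sumBy-+ (F x) (λ y → sumBy (λ x → F x y) xs) ys))

goodWord : ℕ → ℕ → ℕ → List ℕ → Bool
goodWord k i j w = goodRuns k i j (runsOf (dirs w))

indicator : Bool → ℕ
indicator true = 1
indicator false = 0

indicator-∧ : ∀ a b → indicator (a ∧ b) ≡ indicator a * indicator b
indicator-∧ true b = sym (+-identityʳ (indicator b))
indicator-∧ false b = refl

χ : ℕ → ℕ → ℕ → List ℕ → ℕ
χ k i j w = indicator (goodWord k i j w)

<ᵇ-true : ∀ {m n} → m < n → (m <ᵇ n) ≡ true
<ᵇ-true {m} {n} = dec-true (m <? n)

<ᵇ-false : ∀ {m n} → ¬ m < n → (m <ᵇ n) ≡ false
<ᵇ-false {m} {n} = dec-false (m <? n)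

dirs-ascentLast : ∀ x l n → All (_< n) (x ∷ l) → dirs ((x ∷ l) ++ n ∷ []) ≡ dirs (x ∷ l) ++ true ∷ []
dirs-ascentLast x [] n (x<n ∷ _) = cong (_∷ []) (<ᵇ-true x<n)
dirs-ascentLast x (x′ ∷ l) n (_ ∷ l<n) = cong ((x <ᵇ x′) ∷_) (dirs-ascentLast x′ l n l<n)

dirs-peak : ∀ x l n y r → All (_< n) (x ∷ l) → y < n →
  dirs ((x ∷ l) ++ n ∷ y ∷ r) ≡ dirs (x ∷ l) ++ true ∷ false ∷ dirs (y ∷ r)
dirs-peak x [] n y r (x<n ∷ _) y<n = cong₂ (λ a b → a ∷ b ∷ dirs (y ∷ r)) (<ᵇ-true x<n) (<ᵇ-false (<-asym y<n))
dirs-peak x (x′ ∷ l) n y r (_ ∷ l<n) y<n = cong ((x <ᵇ x′) ∷_) (dirs-peak x′ l n y r l<n y<n)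

goodWord-maxFirst : ∀ k i j n y r → i ≤ k → y < n →
  goodWord k i j (n ∷ y ∷ r) ≡ goodWord k (i ∸ 1) j (y ∷ r)
goodWord-maxFirst k i j n y r i≤k y<n = begin
  goodRuns k i j (runsOf ((n <ᵇ y) ∷ dirs (y ∷ r)))  ≡⟨ cong (λ b → goodRuns k i j (runsOf (b ∷ dirs (y ∷ r)))) (<ᵇ-false (<-asym y<n)) ⟩
  goodRuns k i j (runsOf (false ∷ dirs (y ∷ r)))     ≡⟨ cong (goodRuns k i j) (runsOf-cons false (dirs (y ∷ r))) ⟩
  goodRuns k i j (consStep false (runsOf (dirs (y ∷ r)))) ≡⟨ goodRuns-consDescent k i j _ i≤k (runsOf-genuine (dirs (y ∷ r))) ⟩
  goodWord k (i ∸ 1) j (y ∷ r) ∎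
  where open ≡-Reasoning

goodWord-maxLast : ∀ k i j n x l → j ≤ k → All (_< n) (x ∷ l) →
  goodWord k i j ((x ∷ l) ++ n ∷ []) ≡ goodWord k i (j ∸ 1) (x ∷ l)
goodWord-maxLast k i j n x l j≤k l<n = begin
  goodRuns k i j (runsOf (dirs ((x ∷ l) ++ n ∷ []))) ≡⟨ cong (goodRuns k i j ∘ runsOf) (dirs-ascentLast x l n l<n) ⟩
  goodRuns k i j (runsOf (dirs (x ∷ l) ++ true ∷ [])) ≡⟨ cong (goodRuns k i j) (runsOf-snoc (dirs (x ∷ l))) ⟩
  goodRuns k i j (snocAscent (runsOf (dirs (x ∷ l)))) ≡⟨ goodRuns-snocAscent k i j _ j≤k (runsOf-genuine (dirs (x ∷ l))) ⟩
  goodWord k i (j ∸ 1) (x ∷ l) ∎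
  where open ≡-Reasoning

goodWord-maxInside : ∀ k i j n x l y r → All (_< n) (x ∷ l) → y < n →
  goodWord (suc k) i j ((x ∷ l) ++ n ∷ y ∷ r) ≡ goodWord (suc k) i k (x ∷ l) ∧ goodWord (suc k) k j (y ∷ r)
goodWord-maxInside k i j n x l y r l<n y<n = begin
  goodRuns (suc k) i j (runsOf (dirs ((x ∷ l) ++ n ∷ y ∷ r)))
    ≡⟨ cong (goodRuns (suc k) i j ∘ runsOf) (dirs-peak x l n y r l<n y<n) ⟩
  goodRuns (suc k) i j (runsOf (dirs (x ∷ l) ++ true ∷ false ∷ dirs (y ∷ r)))
    ≡⟨ cong (goodRuns (suc k) i j) (runsOf-peak (dirs (x ∷ l)) (dirs (y ∷ r))) ⟩
  goodRuns (suc k) i j (snocAscent (runsOf (dirs (x ∷ l))) ++ consStep false (runsOf (dirs (y ∷ r))))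
    ≡⟨ goodRuns-peak k i j _ _ (runsOf-genuine (dirs (x ∷ l))) (runsOf-genuine (dirs (y ∷ r))) ⟩
  goodWord (suc k) i k (x ∷ l) ∧ goodWord (suc k) k j (y ∷ r) ∎
  where open ≡-Reasoning

insertions : A → List A → List (List A)
insertions x [] = (x ∷ []) ∷ []
insertions x (y ∷ ys) = (x ∷ y ∷ ys) ∷ map (y ∷_) (insertions x ys)

arrangements : List A → List (List A)
arrangements [] = [] ∷ []
arrangements (x ∷ S) = concatMap (insertions x) (arrangements S)

insertAt : ℕ → A → List A → List A
insertAt p x w = take p w ++ x ∷ drop p w

insertions-positions : ∀ (x : A) w → insertions x w ≡ applyUpTo (λ p → insertAt p x w) (suc (length w))
insertions-positions x [] = refl
insertions-positions x (y ∷ ys) =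
  cong ((x ∷ y ∷ ys) ∷_) (trans (cong (map (y ∷_)) (insertions-positions x ys)) (map-applyUpTo (λ p → insertAt p x ys) (y ∷_) (suc (length ys))))

insertions-cases : ∀ (x y : A) ys → insertions x (y ∷ ys) ≡
  (x ∷ y ∷ ys) ∷ (map (λ p → insertAt p x (y ∷ ys)) (applyUpTo suc (length ys)) ++ ((y ∷ ys) ++ x ∷ []) ∷ [])
insertions-cases x y ys = begin
  insertions x (y ∷ ys)
    ≡⟨ insertions-positions x (y ∷ ys) ⟩
  (x ∷ y ∷ ys) ∷ applyUpTo (λ p → F (suc p)) (suc m)
    ≡⟨ cong ((x ∷ y ∷ ys) ∷_) (applyUpTo-∷ʳ (λ p → F (suc p)) m) ⟨
  (x ∷ y ∷ ys) ∷ (applyUpTo (λ p → F (suc p)) m ++ F (suc m) ∷ [])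
    ≡⟨ cong₂ (λ u v → (x ∷ y ∷ ys) ∷ (u ++ v ∷ [])) (map-applyUpTo suc F m) (sym atEnd) ⟨
  (x ∷ y ∷ ys) ∷ (map F (applyUpTo suc m) ++ ((y ∷ ys) ++ x ∷ []) ∷ []) ∎
  where
    open ≡-Reasoning
    m = length ys
    F : ℕ → List _
    F p = insertAt p x (y ∷ ys)
    atEnd : F (suc m) ≡ (y ∷ ys) ++ x ∷ []
    atEnd = cong₂ (λ u v → y ∷ u ++ x ∷ v) (take-all m ys ≤-refl) (drop-all m ys ≤-refl)

drop-nonEmpty : ∀ p (xs : List A) → p < length xs → NonEmpty (drop p xs)
drop-nonEmpty zero (x ∷ xs) _ = tt
drop-nonEmpty (suc p) (x ∷ xs) (s≤s p<n) = drop-nonEmpty p xs p<n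

-- Inserting the maximum n into a nonempty word w in all possible ways: at the
-- front it lengthens the initial descent, at the back the final ascent, and
-- after p entries (0 < p < length w) it creates a peak that separates the
-- first p entries from the rest.
insertMax-count : ∀ k i j n y ys → i ≤ suc k → j ≤ suc k → All (_< n) (y ∷ ys) →
  sumBy (χ (suc k) i j) (insertions n (y ∷ ys)) ≡
  χ (suc k) (i ∸ 1) j (y ∷ ys)
  + (sumBy (λ p → χ (suc k) i k (take p (y ∷ ys)) * χ (suc k) k j (drop p (y ∷ ys))) (applyUpTo suc (length ys))
     + χ (suc k) i (j ∸ 1) (y ∷ ys))
insertMax-count k i j n y ys i≤k j≤k w<n@(y<n ∷ ys<n) = begin
  sumBy (χ K i j) (insertions n w)
    ≡⟨ cong (sumBy (χ K i j)) (insertions-cases n y ys) ⟩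
  χ K i j (n ∷ w) + sumBy (χ K i j) (inside ++ (w ++ n ∷ []) ∷ [])
    ≡⟨ cong (χ K i j (n ∷ w) +_) (sumBy-++ (χ K i j) inside ((w ++ n ∷ []) ∷ [])) ⟩
  χ K i j (n ∷ w) + (sumBy (χ K i j) inside + (χ K i j (w ++ n ∷ []) + 0))
    ≡⟨ cong₂ (λ a b → a + (b + (χ K i j (w ++ n ∷ []) + 0))) atFront (trans (sumBy-map (χ K i j) _ positions) (sumBy-congᴬ (All-applyUpTo⁺₁ suc m atPeak))) ⟩
  χ K (i ∸ 1) j w + (cuts + (χ K i j (w ++ n ∷ []) + 0))
    ≡⟨ cong (λ z → χ K (i ∸ 1) j w + (cuts + z)) atBack ⟩
  χ K (i ∸ 1) j w + (cuts + χ K i (j ∸ 1) w) ∎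
  where
    open ≡-Reasoning
    K = suc k
    m = length ys
    w = y ∷ ys
    positions = applyUpTo suc m
    inside = map (λ p → insertAt p n w) positions
    cuts = sumBy (λ p → χ K i k (take p w) * χ K k j (drop p w)) positions
    atFront : χ K i j (n ∷ w) ≡ χ K (i ∸ 1) j w
    atFront = cong indicator (goodWord-maxFirst K i j n y ys i≤k y<n)
    atBack : χ K i j (w ++ n ∷ []) + 0 ≡ χ K i (j ∸ 1) w
    atBack = trans (+-identityʳ _) (cong indicator (goodWord-maxLast K i j n y ys j≤k w<n))
    atPeak : ∀ {p} → p < m → χ K i j (insertAt (suc p) n w) ≡ χ K i k (take (suc p) w) * χ K k j (drop (suc p) w)
    atPeak {p} p<m with drop p ys | All-drop⁺ p ys<n | drop-nonEmpty p ys p<m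
    ... | z ∷ zs | z<n ∷ _ | _ =
      trans (cong indicator (goodWord-maxInside k i j n y (take p ys) z zs (All-take⁺ (suc p) w<n) z<n))
            (indicator-∧ (goodWord K i k (y ∷ take p ys)) (goodWord K k j (z ∷ zs)))

Unique-resp-↭ : ∀ {xs ys : List ℕ} → xs ↭ ys → Unique xs → Unique ys
Unique-resp-↭ p = ↭ₛ.Unique-resp-↭ (setoid ℕ) (↭⇒↭ₛ p)

∈-concatMap⁻ : ∀ (f : A → List A′) xs {z} → z ∈ concatMap f xs → Σ A λ a → a ∈ xs × z ∈ f a
∈-concatMap⁻ f xs z∈ with ∈-concat⁻′ (map f xs) z∈
... | ys , z∈ys , ys∈ with ∈-map⁻ f ys∈
...   | a , a∈xs , refl = a , a∈xs , z∈ys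

∈-concatMap⁺ : ∀ (f : A → List A′) {xs a z} → a ∈ xs → z ∈ f a → z ∈ concatMap f xs
∈-concatMap⁺ f a∈xs z∈fa = ∈-concat⁺′ z∈fa (∈-map⁺ f a∈xs)

concatMap-unique : ∀ (f : A → List A′) xs → Unique xs → (∀ {a} → a ∈ xs → Unique (f a)) →
  (∀ {a b z} → a ∈ xs → b ∈ xs → z ∈ f a → z ∈ f b → a ≡ b) → Unique (concatMap f xs)
concatMap-unique f [] _ _ _ = []
concatMap-unique f (x ∷ xs) (x∉xs ∷ u) fu inj =
  Unique.++⁺ (fu (here refl)) (concatMap-unique f xs u (λ a∈ → fu (there a∈)) (λ a∈ b∈ → inj (there a∈) (there b∈))) disjoint
  where
    disjoint : ∀ {v} → ¬ (v ∈ f x × v ∈ concatMap f xs)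
    disjoint (v∈fx , v∈rest) with ∈-concatMap⁻ f xs v∈rest
    ... | b , b∈xs , v∈fb = All.lookup x∉xs b∈xs (inj (here refl) (there b∈xs) v∈fx v∈fb)

∈-insertions⇒↭ : ∀ x w {v} → v ∈ insertions {ℕ} x w → v ↭ x ∷ w
∈-insertions⇒↭ x [] (here refl) = ↭-refl
∈-insertions⇒↭ x (y ∷ ys) (here refl) = ↭-refl
∈-insertions⇒↭ x (y ∷ ys) (there v∈) with ∈-map⁻ (y ∷_) v∈
... | u , u∈ , refl = ↭-trans (↭-prep y (∈-insertions⇒↭ x ys u∈)) (↭-swap y x ↭-refl)

insertion-∈-insertions : ∀ x u v → u ++ x ∷ v ∈ insertions {ℕ} x (u ++ v)
insertion-∈-insertions x [] [] = here refl
insertion-∈-insertions x [] (y ∷ ys) = here refl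
insertion-∈-insertions x (a ∷ u) v = there (∈-map⁺ (a ∷_) (insertion-∈-insertions x u v))

∈-arrangements⇒↭ : ∀ S {w} → w ∈ arrangements {ℕ} S → w ↭ S
∈-arrangements⇒↭ [] (here refl) = ↭-refl
∈-arrangements⇒↭ (x ∷ S) w∈ with ∈-concatMap⁻ (insertions x) (arrangements S) w∈
... | u , u∈ , w∈ins = ↭-trans (∈-insertions⇒↭ x u w∈ins) (↭-prep x (∈-arrangements⇒↭ S u∈))

↭⇒∈-arrangements : ∀ S {w} → w ↭ S → w ∈ arrangements {ℕ} S
↭⇒∈-arrangements [] w↭ rewrite ↭-empty-inv w↭ = here refl
↭⇒∈-arrangements (x ∷ S) w↭ with ∈-∃++ (∈-resp-↭ (↭-sym w↭) (here refl))
... | u , v , refl = ∈-concatMap⁺ (insertions x) (↭⇒∈-arrangements S (drop-mid u [] w↭)) (insertion-∈-insertions x u v)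

-- Deleting the first occurrence of x undoes an insertion of a fresh x.
removeFirst : ℕ → List ℕ → List ℕ
removeFirst x [] = []
removeFirst x (a ∷ z) with a ≟ x
... | yes _ = z
... | no _ = a ∷ removeFirst x z

removeFirst-insertions : ∀ x w {v} → ¬ x ∈ w → v ∈ insertions x w → removeFirst x v ≡ w
removeFirst-insertions x [] _ (here refl) with x ≟ x
... | yes _ = refl
... | no x≢x = ⊥-elim (x≢x refl)
removeFirst-insertions x (y ∷ ys) _ (here refl) with x ≟ x
... | yes _ = refl
... | no x≢x = ⊥-elim (x≢x refl)
removeFirst-insertions x (y ∷ ys) x∉ (there v∈) with ∈-map⁻ (y ∷_) v∈
... | u , u∈ , refl with y ≟ x
...   | yes y≡x = ⊥-elim (x∉ (here (sym y≡x)))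
...   | no _ = cong (y ∷_) (removeFirst-insertions x ys (λ x∈ → x∉ (there x∈)) u∈)

insertions-unique : ∀ (x : ℕ) w → ¬ x ∈ w → Unique (insertions x w)
insertions-unique x [] _ = [] ∷ []
insertions-unique x (y ∷ ys) x∉ =
  All.tabulate (λ {v} v∈ e → x∉ (here (∷-injectiveˡ (trans e (proj₂ (proj₂ (∈-map⁻ (y ∷_) v∈)))))))
  ∷ Unique.map⁺ ∷-injectiveʳ (insertions-unique x ys (λ x∈ → x∉ (there x∈)))

arrangements-unique : ∀ S → Unique S → Unique (arrangements {ℕ} S)
arrangements-unique [] _ = [] ∷ []
arrangements-unique (x ∷ S) (x∉S ∷ uS) =
  concatMap-unique (insertions x) (arrangements S) (arrangements-unique S uS)
    (λ u∈ → insertions-unique x _ (fresh u∈))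
    (λ a∈ b∈ z∈a z∈b → trans (sym (removeFirst-insertions x _ (fresh a∈) z∈a)) (removeFirst-insertions x _ (fresh b∈) z∈b))
  where
    fresh : ∀ {u} → u ∈ arrangements {ℕ} S → ¬ x ∈ u
    fresh u∈ x∈u = All.lookup x∉S (∈-resp-↭ (∈-arrangements⇒↭ S u∈) x∈u) refl

∈-words⁻ : ∀ m l {z} → z ∈ words m l → length z ≡ l × All (_∈ applyUpTo suc m) z
∈-words⁻ m zero (here refl) = refl , []
∈-words⁻ m (suc l) z∈ with ∈-concatMap⁻ (λ w → map (_∷ w) (applyUpTo suc m)) (words m l) z∈
... | w , w∈ , z∈′ with ∈-map⁻ (_∷ w) z∈′
...   | a , a∈ , refl = cong suc (proj₁ (∈-words⁻ m l w∈)) , a∈ ∷ proj₂ (∈-words⁻ m l w∈)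

∈-words⁺ : ∀ m l z → length z ≡ l → All (_∈ applyUpTo suc m) z → z ∈ words m l
∈-words⁺ m zero [] _ _ = here refl
∈-words⁺ m (suc l) (a ∷ z) len (a∈ ∷ z⊆) =
  ∈-concatMap⁺ (λ w → map (_∷ w) (applyUpTo suc m)) (∈-words⁺ m l z (suc-injective len) z⊆) (∈-map⁺ (_∷ z) a∈)

words-unique : ∀ m l → Unique (words m l)
words-unique m zero = [] ∷ []
words-unique m (suc l) =
  concatMap-unique (λ w → map (_∷ w) letters) (words m l) (words-unique m l)
    (λ _ → Unique.map⁺ ∷-injectiveˡ letters-unique) (λ _ _ → sameTail)
  where
    letters = applyUpTo suc m
    letters-unique : Unique letters
    letters-unique = Unique.applyUpTo⁺₁ suc m (λ i<j _ e → <⇒≢ i<j (suc-injective e))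
    sameTail : ∀ {a b z} → z ∈ map (_∷ a) letters → z ∈ map (_∷ b) letters → a ≡ b
    sameTail z∈a z∈b with ∈-map⁻ _ z∈a | ∈-map⁻ _ z∈b
    ... | _ , _ , refl | _ , _ , e = ∷-injectiveʳ e

down : ℕ → List ℕ
down n = applyDownFrom suc n

down-unique : ∀ n → Unique (down n)
down-unique n = Unique.applyDownFrom⁺₁ suc n (λ j<i _ e → <⇒≢ j<i (sym (suc-injective e)))

up↭down : ∀ n → applyUpTo suc n ↭ down n
up↭down n = subst (applyUpTo suc n ↭_) (reverse-applyUpTo suc n) (↭-sym (↭-reverse (applyUpTo suc n)))

unique-⊆⇒↭ : ∀ {xs ys : List ℕ} → Unique xs → All (_∈ ys) xs → length ys ≤ length xs → xs ↭ ys
unique-⊆⇒↭ {[]} {[]} _ _ _ = ↭-refl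
unique-⊆⇒↭ {x ∷ xs} (x∉xs ∷ uxs) (x∈ys ∷ xs⊆ys) len with ∈-∃++ x∈ys
... | ys₁ , ys₂ , refl =
  ↭-trans (↭-prep x (unique-⊆⇒↭ uxs (All.zipWith stillIn (x∉xs , xs⊆ys)) len′)) (↭-sym (shift x ys₁ ys₂))
  where
    stillIn : ∀ {a} → ¬ x ≡ a × a ∈ ys₁ ++ x ∷ ys₂ → a ∈ ys₁ ++ ys₂
    stillIn (x≢a , a∈) with ∈-resp-↭ (shift x ys₁ ys₂) a∈
    ... | here a≡x = ⊥-elim (x≢a (sym a≡x))
    ... | there a∈′ = a∈′
    len′ : length (ys₁ ++ ys₂) ≤ length xs
    len′ = s≤s⁻¹ (subst (_≤ suc (length xs)) (↭-length (shift x ys₁ ys₂)) len)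

does⇒ : ∀ {P : Set} (d : Dec P) → T (does d) → P
does⇒ (yes p) _ = p

perms↭arrangements : ∀ n → perms n ↭ arrangements (down n)
perms↭arrangements n =
  ∼bag⇒↭ (unique∧set⇒bag (Unique.filter⁺ (T? ∘ isPerm) (words-unique n n)) (arrangements-unique (down n) (down-unique n))
                          (mk⇔ toArrangement toPerm))
  where
    toArrangement : ∀ {z} → z ∈ perms n → z ∈ arrangements (down n)
    toArrangement {z} z∈ with ∈-filter⁻ (T? ∘ isPerm) z∈
    ... | z∈words , isPerm-z with ∈-words⁻ n n z∈words
    ...   | len , z⊆up = ↭⇒∈-arrangements (down n)
              (unique-⊆⇒↭ (does⇒ (unique? z) isPerm-z) (All.map (∈-resp-↭ (up↭down n)) z⊆up)
                          (subst (_≤ length z) (sym (length-applyDownFrom suc n)) (≤-reflexive (sym len))))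
    toPerm : ∀ {z} → z ∈ arrangements (down n) → z ∈ perms n
    toPerm {z} z∈ = ∈-filter⁺ (T? ∘ isPerm)
      (∈-words⁺ n n z (trans (↭-length z↭) (length-applyDownFrom suc n))
                      (All.map (∈-resp-↭ (↭-sym (up↭down n))) (All-resp-↭ (↭-sym z↭) (All.tabulate (λ a∈ → a∈)))))
      (Equivalence.from T-≡ (dec-true (unique? z) (Unique-resp-↭ (↭-sym z↭) (down-unique n))))
      where z↭ = ∈-arrangements⇒↭ (down n) z∈

count-filter : ∀ (P : A → Bool) xs → length (filterᵇ P xs) ≡ sumBy (λ x → indicator (P x)) xs
count-filter P [] = refl
count-filter P (x ∷ xs) with P x
... | true = cong suc (count-filter P xs)
... | false = count-filter P xs

good-count : ∀ k i j n →
  length (filterᵇ (good k (suc i) (suc j)) (perms n)) ≡ sumBy (χ k (suc i) (suc j)) (arrangements (down n))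
good-count k i j n = begin
  length (filterᵇ (good k (suc i) (suc j)) (perms n))
    ≡⟨ ↭-length (filter-↭ (T? ∘ good k (suc i) (suc j)) (perms↭arrangements n)) ⟩
  length (filterᵇ (good k (suc i) (suc j)) (arrangements (down n)))
    ≡⟨ count-filter (good k (suc i) (suc j)) (arrangements (down n)) ⟩
  sumBy (λ w → indicator (good k (suc i) (suc j) w)) (arrangements (down n))
    ≡⟨ sumBy-cong (λ w → cong indicator (good-goodRuns k i j w)) (arrangements (down n)) ⟩
  sumBy (χ k (suc i) (suc j)) (arrangements (down n)) ∎
  where open ≡-Reasoning

B-arrangements : ∀ k i j n → B k i j n ≡ sumBy (χ k i j) (arrangements (down n))
B-arrangements k zero j n = sym (sumBy-zero (arrangements (down n)))
B-arrangements k (suc i) zero n = sym (sumBy-zero (arrangements (down n)))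
B-arrangements k (suc i) (suc j) zero = good-count k i j zero
B-arrangements k (suc i) (suc j) (suc zero) = refl
B-arrangements k (suc i) (suc j) (suc (suc n)) = good-count k i j (suc (suc n))

Decreasing : List ℕ → Set
Decreasing = AllPairs (λ a b → b < a)

down-decreasing : ∀ n → Decreasing (down n)
down-decreasing n = AllPairs.applyDownFrom⁺₁ suc n (λ j<i _ → s≤s j<i)

down-bounded : ∀ n → All (_≤ n) (down n)
down-bounded n = All-applyDownFrom⁺₁ suc n (λ i<n → i<n)

insertions-map : ∀ (g : ℕ → ℕ) x w → insertions (g x) (map g w) ≡ map (map g) (insertions x w)
insertions-map g x [] = refl
insertions-map g x (y ∷ ys) = cong ((g x ∷ g y ∷ map g ys) ∷_) (begin
  map (g y ∷_) (insertions (g x) (map g ys))     ≡⟨ cong (map (g y ∷_)) (insertions-map g x ys) ⟩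
  map (g y ∷_) (map (map g) (insertions x ys))   ≡⟨ map-∘ (insertions x ys) ⟨
  map (λ v → g y ∷ map g v) (insertions x ys)    ≡⟨ map-∘ (insertions x ys) ⟩
  map (map g) (map (y ∷_) (insertions x ys))     ∎)
  where open ≡-Reasoning

sumBy-arrangements-map : ∀ (F : List ℕ → ℕ) (g : ℕ → ℕ) S →
  sumBy F (arrangements (map g S)) ≡ sumBy (λ w → F (map g w)) (arrangements S)
sumBy-arrangements-map F g [] = refl
sumBy-arrangements-map F g (x ∷ S) = begin
  sumBy F (concatMap (insertions (g x)) (arrangements (map g S)))
    ≡⟨ sumBy-concatMap F (insertions (g x)) (arrangements (map g S)) ⟩
  sumBy (λ w → sumBy F (insertions (g x) w)) (arrangements (map g S))
    ≡⟨ sumBy-arrangements-map (λ w → sumBy F (insertions (g x) w)) g S ⟩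
  sumBy (λ w → sumBy F (insertions (g x) (map g w))) (arrangements S)
    ≡⟨ sumBy-cong (λ w → trans (cong (sumBy F) (insertions-map g x w)) (sumBy-map F (map g) (insertions x w))) (arrangements S) ⟩
  sumBy (λ w → sumBy (λ v → F (map g v)) (insertions x w)) (arrangements S)
    ≡⟨ sumBy-concatMap (λ v → F (map g v)) (insertions x) (arrangements S) ⟨
  sumBy (λ w → F (map g w)) (arrangements (x ∷ S)) ∎
  where open ≡-Reasoning

dirs-map : ∀ (g : ℕ → ℕ) (D : ℕ → Set) → (∀ {a b} → D a → D b → a < b → g a < g b) →
  ∀ w → All D w → dirs (map g w) ≡ dirs w
dirs-map g D mono [] _ = refl
dirs-map g D mono (a ∷ []) _ = refl
dirs-map g D mono (a ∷ b ∷ w) (Da ∷ Db ∷ Dw) = cong₂ _∷_ sameComparison (dirs-map g D mono (b ∷ w) (Db ∷ Dw))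
  where
    sameComparison : (g a <ᵇ g b) ≡ (a <ᵇ b)
    sameComparison with <-cmp a b
    ... | tri< a<b _ _ = trans (<ᵇ-true (mono Da Db a<b)) (sym (<ᵇ-true a<b))
    ... | tri≈ _ refl _ = trans (<ᵇ-false (n≮n (g a))) (sym (<ᵇ-false (n≮n a)))
    ... | tri> _ _ b<a = trans (<ᵇ-false (<-asym (mono Db Da b<a))) (sym (<ᵇ-false (<-asym b<a)))

-- The order-preserving map sending 1, …, length ys onto the decreasing list ys.
relabel : List ℕ → ℕ → ℕ
relabel [] a = a
relabel (x ∷ ys) a with a ≟ suc (length ys)
... | yes _ = x
... | no _ = relabel ys a

relabel-top : ∀ x ys → relabel (x ∷ ys) (suc (length ys)) ≡ x
relabel-top x ys with suc (length ys) ≟ suc (length ys)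
... | yes _ = refl
... | no ≢ = ⊥-elim (≢ refl)

relabel-below : ∀ x ys {a} → a ≤ length ys → relabel (x ∷ ys) a ≡ relabel ys a
relabel-below x ys {a} a≤ with a ≟ suc (length ys)
... | yes refl = ⊥-elim (n≮n (length ys) a≤)
... | no _ = refl

relabel-down : ∀ ys → map (relabel ys) (down (length ys)) ≡ ys
relabel-down [] = refl
relabel-down (x ∷ ys) = cong₂ _∷_ (relabel-top x ys)
  (trans (map-cong-local (All.map (relabel-below x ys) (down-bounded (length ys)))) (relabel-down ys))

relabel-∈ : ∀ {P : ℕ → Set} ys → All P ys → ∀ {a} → a ∈ down (length ys) → P (relabel ys a)
relabel-∈ (x ∷ ys) (Px ∷ Pys) (here refl) rewrite relabel-top x ys = Px
relabel-∈ (x ∷ ys) (Px ∷ Pys) {a} (there a∈) rewrite relabel-below x ys (All.lookup (down-bounded (length ys)) a∈) = relabel-∈ ys Pys a∈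

relabel-monotone : ∀ ys → Decreasing ys → ∀ {a b} → a ∈ down (length ys) → b ∈ down (length ys) → a < b → relabel ys a < relabel ys b
relabel-monotone (x ∷ ys) (ys<x ∷ decYs) (here refl) (here refl) a<b = ⊥-elim (n≮n _ a<b)
relabel-monotone (x ∷ ys) (ys<x ∷ decYs) (here refl) (there b∈) a<b =
  ⊥-elim (n≮n _ (<-≤-trans a<b (m≤n⇒m≤1+n (All.lookup (down-bounded (length ys)) b∈))))
relabel-monotone (x ∷ ys) (ys<x ∷ decYs) {a} (there a∈) (here refl) _
  rewrite relabel-top x ys | relabel-below x ys (All.lookup (down-bounded (length ys)) a∈) = relabel-∈ ys ys<x a∈
relabel-monotone (x ∷ ys) (ys<x ∷ decYs) {a} {b} (there a∈) (there b∈) a<b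
  rewrite relabel-below x ys (All.lookup (down-bounded (length ys)) a∈) | relabel-below x ys (All.lookup (down-bounded (length ys)) b∈)
  = relabel-monotone ys decYs a∈ b∈ a<b

relabel-invariance : ∀ (G : List Bool → ℕ) ys → Decreasing ys →
  sumBy (λ w → G (dirs w)) (arrangements ys) ≡ sumBy (λ w → G (dirs w)) (arrangements (down (length ys)))
relabel-invariance G ys decYs = begin
  sumBy (λ w → G (dirs w)) (arrangements ys)
    ≡⟨ cong (λ S → sumBy (λ w → G (dirs w)) (arrangements S)) (relabel-down ys) ⟨
  sumBy (λ w → G (dirs w)) (arrangements (map g (down L)))
    ≡⟨ sumBy-arrangements-map (λ w → G (dirs w)) g (down L) ⟩
  sumBy (λ w → G (dirs (map g w))) (arrangements (down L))
    ≡⟨ sumBy-congᴬ (All.tabulate (λ w∈ → cong G (dirs-map g (_∈ down L) (relabel-monotone ys decYs) _ (entries w∈)))) ⟩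
  sumBy (λ w → G (dirs w)) (arrangements (down L)) ∎
  where
    open ≡-Reasoning
    L = length ys
    g = relabel ys
    entries : ∀ {w} → w ∈ arrangements (down L) → All (_∈ down L) w
    entries w∈ = All.tabulate (∈-resp-↭ (∈-arrangements⇒↭ (down L) w∈))

-- All ways of distributing the entries of S into a left part with q entries
-- and a right part, both keeping the order of S.
splits : ℕ → List ℕ → List (List ℕ × List ℕ)
splits zero S = ([] , S) ∷ []
splits (suc q) [] = []
splits (suc q) (x ∷ S) = map (map₁ (x ∷_)) (splits q S) ++ map (map₂ (x ∷_)) (splits (suc q) S)

-- By Pascal's rule there are (length S choose q) splits.
splits-length : ∀ q S → length (splits q S) ≡ length S C q
splits-length zero S = refl
splits-length (suc q) [] = refl
splits-length (suc q) (x ∷ S) = begin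
  length (map (map₁ (x ∷_)) (splits q S) ++ map (map₂ (x ∷_)) (splits (suc q) S))
    ≡⟨ length-++ (map (map₁ (x ∷_)) (splits q S)) ⟩
  length (map (map₁ (x ∷_)) (splits q S)) + length (map (map₂ (x ∷_)) (splits (suc q) S))
    ≡⟨ cong₂ _+_ (length-map (map₁ (x ∷_)) (splits q S)) (length-map (map₂ (x ∷_)) (splits (suc q) S)) ⟩
  length (splits q S) + length (splits (suc q) S)
    ≡⟨ cong₂ _+_ (splits-length q S) (splits-length (suc q) S) ⟩
  length S C q + length S C suc q
    ≡⟨ nCk+nC[k+1]≡[n+1]C[k+1] (length S) q ⟩
  suc (length S) C suc q ∎
  where open ≡-Reasoning

splits-tooMany : ∀ q S → length S < q → splits q S ≡ []
splits-tooMany (suc q) [] _ = refl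
splits-tooMany (suc q) (x ∷ S) (s≤s |S|<q)
  rewrite splits-tooMany q S |S|<q | splits-tooMany (suc q) S (m≤n⇒m≤1+n |S|<q) = refl

splitSum : (List ℕ → ℕ) → (List ℕ → ℕ) → List (List ℕ × List ℕ) → ℕ
splitSum f g = sumBy (λ LR → sumBy f (arrangements (proj₁ LR)) * sumBy g (arrangements (proj₂ LR)))

-- Cutting an arrangement after position q+1 once x has been inserted: x lands
-- either in the left piece (an insertion into the first q entries) or in the
-- right piece (an insertion into the entries after position q+1).
insertion-cut : ∀ x w q (f g : List ℕ → ℕ) → q < length w →
  sumBy (λ v → f (take (suc q) v) * g (drop (suc q) v)) (insertions x w) ≡
  sumBy f (insertions x (take q w)) * g (drop q w) + f (take (suc q) w) * sumBy g (insertions x (drop (suc q) w))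
insertion-cut x (y ∷ ys) zero f g _ = begin
  f (x ∷ []) * g (y ∷ ys) + sumBy (λ v → f (take 1 v) * g (drop 1 v)) (map (y ∷_) (insertions x ys))
    ≡⟨ cong (f (x ∷ []) * g (y ∷ ys) +_) (trans (sumBy-map _ (y ∷_) (insertions x ys)) (sumBy-*ˡ (f (y ∷ [])) g (insertions x ys))) ⟩
  f (x ∷ []) * g (y ∷ ys) + f (y ∷ []) * sumBy g (insertions x ys)
    ≡⟨ cong (λ z → z * g (y ∷ ys) + f (y ∷ []) * sumBy g (insertions x ys)) (+-identityʳ (f (x ∷ []))) ⟨
  (f (x ∷ []) + 0) * g (y ∷ ys) + f (y ∷ []) * sumBy g (insertions x ys) ∎
  where open ≡-Reasoning
insertion-cut x (y ∷ ys) (suc q) f g (s≤s q<m) = begin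
  a * c + sumBy (λ v → f (take (suc (suc q)) v) * g (drop (suc (suc q)) v)) (map (y ∷_) (insertions x ys))
    ≡⟨ cong (a * c +_) (trans (sumBy-map _ (y ∷_) (insertions x ys)) (insertion-cut x ys q (λ u → f (y ∷ u)) g q<m)) ⟩
  a * c + (b * c + d)
    ≡⟨ +-assoc (a * c) (b * c) d ⟨
  (a * c + b * c) + d
    ≡⟨ cong (_+ d) (*-distribʳ-+ c a b) ⟨
  (a + b) * c + d
    ≡⟨ cong (λ z → (a + z) * c + d) (sumBy-map f (y ∷_) (insertions x (take q ys))) ⟨
  sumBy f (insertions x (y ∷ take q ys)) * c + d ∎
  where
    open ≡-Reasoning
    a = f (x ∷ y ∷ take q ys)
    b = sumBy (λ u → f (y ∷ u)) (insertions x (take q ys))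
    c = g (drop q ys)
    d = f (y ∷ take (suc q) ys) * sumBy g (insertions x (drop (suc q) ys))

insertion-cut-end : ∀ x w (f g : List ℕ → ℕ) →
  sumBy (λ v → f (take (suc (length w)) v) * g (drop (suc (length w)) v)) (insertions x w) ≡
  sumBy f (insertions x w) * g []
insertion-cut-end x w f g =
  trans (sumBy-congᴬ (All.tabulate whole)) (sumBy-*ʳ (g []) f (insertions x w))
  where
    whole : ∀ {v} → v ∈ insertions x w →
      f (take (suc (length w)) v) * g (drop (suc (length w)) v) ≡ f v * g []
    whole {v} v∈ = let len = ↭-length (∈-insertions⇒↭ x w v∈) in
      cong₂ (λ u u′ → f u * g u′) (take-all _ _ (≤-reflexive len)) (drop-all _ v (≤-reflexive len))

arrangement-length : ∀ S {w} → w ∈ arrangements S → length w ≡ length S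
arrangement-length S w∈ = ↭-length (∈-arrangements⇒↭ S w∈)

splitSum-consLeft : ∀ x f g P → splitSum f g (map (map₁ (x ∷_)) P) ≡ splitSum (λ u → sumBy f (insertions x u)) g P
splitSum-consLeft x f g P = trans (sumBy-map _ (map₁ (x ∷_)) P)
  (sumBy-cong (λ LR → cong (_* sumBy g (arrangements (proj₂ LR))) (sumBy-concatMap f (insertions x) (arrangements (proj₁ LR)))) P)

splitSum-consRight : ∀ x f g P → splitSum f g (map (map₂ (x ∷_)) P) ≡ splitSum f (λ u → sumBy g (insertions x u)) P
splitSum-consRight x f g P = trans (sumBy-map _ (map₂ (x ∷_)) P)
  (sumBy-cong (λ LR → cong (sumBy f (arrangements (proj₁ LR)) *_) (sumBy-concatMap g (insertions x) (arrangements (proj₂ LR)))) P)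

-- The shuffle identity: cutting every arrangement of S after position q is
-- the same as choosing which q entries go to the left and arranging the two
-- sides independently.
shuffle : ∀ S q (f g : List ℕ → ℕ) → q ≤ length S →
  sumBy (λ w → f (take q w) * g (drop q w)) (arrangements S) ≡ splitSum f g (splits q S)
shuffle S zero f g _ = begin
  sumBy (λ w → f [] * g w) (arrangements S)  ≡⟨ sumBy-*ˡ (f []) g (arrangements S) ⟩
  f [] * sumBy g (arrangements S)            ≡⟨ cong (_* sumBy g (arrangements S)) (+-identityʳ (f [])) ⟨
  (f [] + 0) * sumBy g (arrangements S)      ≡⟨ +-identityʳ _ ⟨
  (f [] + 0) * sumBy g (arrangements S) + 0 ∎
  where open ≡-Reasoning
shuffle (x ∷ S) (suc q) f g (s≤s q≤m) = begin
  sumBy (λ w → f (take (suc q) w) * g (drop (suc q) w)) (arrangements (x ∷ S))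
    ≡⟨ sumBy-concatMap _ (insertions x) (arrangements S) ⟩
  sumBy (λ w → sumBy (λ v → f (take (suc q) v) * g (drop (suc q) v)) (insertions x w)) (arrangements S)
    ≡⟨ cutEach (m≤n⇒m<n∨m≡n q≤m) ⟩
  splitSum F g (splits q S) + splitSum f G (splits (suc q) S)
    ≡⟨ cong₂ _+_ (splitSum-consLeft x f g (splits q S)) (splitSum-consRight x f g (splits (suc q) S)) ⟨
  splitSum f g (map (map₁ (x ∷_)) (splits q S)) + splitSum f g (map (map₂ (x ∷_)) (splits (suc q) S))
    ≡⟨ sumBy-++ _ (map (map₁ (x ∷_)) (splits q S)) _ ⟨
  splitSum f g (splits (suc q) (x ∷ S)) ∎
  where
    open ≡-Reasoning
    F G : List ℕ → ℕ
    F u = sumBy f (insertions x u)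
    G u = sumBy g (insertions x u)
    atEnd : ∀ w q → length w ≡ q →
      sumBy (λ v → f (take (suc q) v) * g (drop (suc q) v)) (insertions x w) ≡ F (take q w) * g (drop q w)
    atEnd w _ refl = trans (insertion-cut-end x w f g)
      (cong₂ (λ u u′ → F u * g u′) (sym (take-all _ w ≤-refl)) (sym (drop-all _ w ≤-refl)))
    cutEach : q < length S ⊎ q ≡ length S →
      sumBy (λ w → sumBy (λ v → f (take (suc q) v) * g (drop (suc q) v)) (insertions x w)) (arrangements S) ≡
      splitSum F g (splits q S) + splitSum f G (splits (suc q) S)
    cutEach (inj₁ q<m) = begin
      _ ≡⟨ sumBy-congᴬ (All.tabulate (λ w∈ → insertion-cut x _ q f g (subst (q <_) (sym (arrangement-length S w∈)) q<m))) ⟩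
      sumBy (λ w → F (take q w) * g (drop q w) + f (take (suc q) w) * G (drop (suc q) w)) (arrangements S)
        ≡⟨ sumBy-+ _ _ (arrangements S) ⟩
      _ ≡⟨ cong₂ _+_ (shuffle S q F g q≤m) (shuffle S (suc q) f G q<m) ⟩
      splitSum F g (splits q S) + splitSum f G (splits (suc q) S) ∎
    cutEach (inj₂ q≡m) = begin
      _ ≡⟨ sumBy-congᴬ (All.tabulate (λ w∈ → atEnd _ q (trans (arrangement-length S w∈) (sym q≡m)))) ⟩
      sumBy (λ w → F (take q w) * g (drop q w)) (arrangements S)  ≡⟨ shuffle S q F g q≤m ⟩
      splitSum F g (splits q S)                                     ≡⟨ +-identityʳ _ ⟨
      splitSum F g (splits q S) + 0
        ≡⟨ cong (λ P → splitSum F g (splits q S) + splitSum f G P) (splits-tooMany (suc q) S (s≤s (≤-reflexive (sym q≡m)))) ⟨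
      splitSum F g (splits q S) + splitSum f G (splits (suc q) S) ∎

splits-All : ∀ {P : ℕ → Set} q S → All P S → All (λ LR → All P (proj₁ LR) × All P (proj₂ LR)) (splits q S)
splits-All zero S PS = ([] , PS) ∷ []
splits-All (suc q) [] _ = []
splits-All (suc q) (x ∷ S) (Px ∷ PS) = All-++⁺
  (All-map⁺ (All.map (λ { (PL , PR) → Px ∷ PL , PR }) (splits-All q S PS)))
  (All-map⁺ (All.map (λ { (PL , PR) → PL , Px ∷ PR }) (splits-All (suc q) S PS)))

splits-decreasing : ∀ q S → Decreasing S → All (λ LR → Decreasing (proj₁ LR) × Decreasing (proj₂ LR)) (splits q S)
splits-decreasing zero S decS = ([] , decS) ∷ []
splits-decreasing (suc q) [] _ = []
splits-decreasing (suc q) (x ∷ S) (S<x ∷ decS) = All-++⁺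
  (All-map⁺ (All.zipWith (λ { ((decL , decR) , (L<x , _)) → L<x ∷ decL , decR }) (splits-decreasing q S decS , splits-All q S S<x)))
  (All-map⁺ (All.zipWith (λ { ((decL , decR) , (_ , R<x)) → decL , R<x ∷ decR }) (splits-decreasing (suc q) S decS , splits-All (suc q) S S<x)))

splits-sizes : ∀ q S → All (λ LR → length (proj₁ LR) ≡ q × length (proj₁ LR) + length (proj₂ LR) ≡ length S) (splits q S)
splits-sizes zero S = (refl , refl) ∷ []
splits-sizes (suc q) [] = []
splits-sizes (suc q) (x ∷ S) = All-++⁺
  (All-map⁺ (All.map (λ { (lenL , lenLR) → cong suc lenL , cong suc lenLR }) (splits-sizes q S)))
  (All-map⁺ (All.map (λ { {L , R} (lenL , lenLR) → lenL , trans (+-suc (length L) (length R)) (cong suc lenLR) }) (splits-sizes (suc q) S)))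

-- For quantities depending only on ascents/descents, every split of a
-- decreasing list contributes the same amount, and there are |S| choose q splits.
splitSum-relabel : ∀ (G₁ G₂ : List Bool → ℕ) q S → Decreasing S →
  splitSum (λ w → G₁ (dirs w)) (λ w → G₂ (dirs w)) (splits q S) ≡
  (length S C q) * (sumBy (λ w → G₁ (dirs w)) (arrangements (down q)) * sumBy (λ w → G₂ (dirs w)) (arrangements (down (length S ∸ q))))
splitSum-relabel G₁ G₂ q S decS = begin
  splitSum F₁ F₂ (splits q S)
    ≡⟨ sumBy-const (splits q S) (All.zipWith eachSplit (splits-decreasing q S decS , splits-sizes q S)) ⟩
  length (splits q S) * (sumBy F₁ (arrangements (down q)) * sumBy F₂ (arrangements (down (length S ∸ q))))
    ≡⟨ cong (_* (sumBy F₁ (arrangements (down q)) * sumBy F₂ (arrangements (down (length S ∸ q))))) (splits-length q S) ⟩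
  (length S C q) * (sumBy F₁ (arrangements (down q)) * sumBy F₂ (arrangements (down (length S ∸ q)))) ∎
  where
    open ≡-Reasoning
    F₁ F₂ : List ℕ → ℕ
    F₁ w = G₁ (dirs w)
    F₂ w = G₂ (dirs w)
    eachSplit : ∀ {LR} → (Decreasing (proj₁ LR) × Decreasing (proj₂ LR)) ×
                         (length (proj₁ LR) ≡ q × length (proj₁ LR) + length (proj₂ LR) ≡ length S) →
      sumBy F₁ (arrangements (proj₁ LR)) * sumBy F₂ (arrangements (proj₂ LR)) ≡
      sumBy F₁ (arrangements (down q)) * sumBy F₂ (arrangements (down (length S ∸ q)))
    eachSplit {L , R} ((decL , decR) , (refl , lenLR)) = cong₂ _*_
      (relabel-invariance G₁ L decL)
      (trans (relabel-invariance G₂ R decR) (cong (λ r → sumBy F₂ (arrangements (down r))) lenR))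
      where lenR : length R ≡ length S ∸ length L
            lenR = sym (trans (cong (_∸ length L) (sym lenLR)) (m+n∸m≡n (length L) (length R)))

-- Inserting the maximum n into all arrangements of a nonempty list S of
-- smaller entries: the recursion of the theorem before relabelling.
arrangements-insertMax : ∀ k i j n s S′ → i ≤ suc k → j ≤ suc k → All (_< n) (s ∷ S′) →
  sumBy (χ (suc k) i j) (arrangements (n ∷ s ∷ S′)) ≡
  sumBy (χ (suc k) (i ∸ 1) j) (arrangements (s ∷ S′))
  + (sumBy (λ p → splitSum (χ (suc k) i k) (χ (suc k) k j) (splits p (s ∷ S′))) (applyUpTo suc (length S′))
     + sumBy (χ (suc k) i (j ∸ 1)) (arrangements (s ∷ S′)))
arrangements-insertMax k i j n s S′ i≤k j≤k S<n = begin
  sumBy (χ K i j) (concatMap (insertions n) (arrangements S))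
    ≡⟨ sumBy-concatMap (χ K i j) (insertions n) (arrangements S) ⟩
  sumBy (λ w → sumBy (χ K i j) (insertions n w)) (arrangements S)
    ≡⟨ sumBy-congᴬ (All.tabulate atEach) ⟩
  sumBy (λ w → front w + (cuts w + back w)) (arrangements S)
    ≡⟨ trans (sumBy-+ front _ (arrangements S)) (cong (sumBy front (arrangements S) +_) (sumBy-+ cuts back (arrangements S))) ⟩
  sumBy front (arrangements S) + (sumBy cuts (arrangements S) + sumBy back (arrangements S))
    ≡⟨ cong (λ z → sumBy front (arrangements S) + (z + sumBy back (arrangements S))) cutsByPosition ⟩
  sumBy front (arrangements S) + (sumBy (λ p → splitSum (χ K i k) (χ K k j) (splits p S)) positions + sumBy back (arrangements S)) ∎
  where
    open ≡-Reasoning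
    K = suc k
    S = s ∷ S′
    positions = applyUpTo suc (length S′)
    front back cuts : List ℕ → ℕ
    front = χ K (i ∸ 1) j
    back = χ K i (j ∸ 1)
    cuts w = sumBy (λ p → χ K i k (take p w) * χ K k j (drop p w)) positions
    atEach : ∀ {w} → w ∈ arrangements S → sumBy (χ K i j) (insertions n w) ≡ front w + (cuts w + back w)
    atEach {[]} w∈ with arrangement-length S w∈
    ... | ()
    atEach {y ∷ ys} w∈ = subst (λ m → sumBy (χ K i j) (insertions n (y ∷ ys)) ≡ front (y ∷ ys) + (sumBy (λ p → χ K i k (take p (y ∷ ys)) * χ K k j (drop p (y ∷ ys))) (applyUpTo suc m) + back (y ∷ ys)))
      (suc-injective (arrangement-length S w∈))
      (insertMax-count k i j n y ys i≤k j≤k (All-resp-↭ (↭-sym (∈-arrangements⇒↭ S w∈)) S<n))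
    cutsByPosition : sumBy cuts (arrangements S) ≡ sumBy (λ p → splitSum (χ K i k) (χ K k j) (splits p S)) positions
    cutsByPosition = trans (sumBy-swap (λ w p → χ K i k (take p w) * χ K k j (drop p w)) (arrangements S) positions)
      (sumBy-congᴬ (All-applyUpTo⁺₁ suc (length S′) (λ p<m → shuffle S _ (χ K i k) (χ K k j) (s≤s (<⇒≤ p<m)))))

sum-map : ∀ (f : A → ℕ) xs → sum (map f xs) ≡ sumBy f xs
sum-map f [] = refl
sum-map f (x ∷ xs) = cong (f x +_) (sum-map f xs)

-- The convolution term of the recursion: the entries left of n form a set of
-- t - 1 of the n - 1 smaller values, arranged with final increasing run below k,
-- and those right of n the complementary set, with initial decreasing run below k.
convolution : ∀ k i j m →
  sumBy (λ p → splitSum (χ (suc k) i k) (χ (suc k) k j) (splits p (down (suc m)))) (applyUpTo suc (length (down m))) ≡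
  sumFrom2 (suc (suc m)) (λ t → ((suc m) C (t ∸ 1)) * B (suc k) i k (t ∸ 1) * B (suc k) k j (suc (suc m) ∸ t))
convolution k i j m = begin
  sumBy (λ p → splitSum (χ K i k) (χ K k j) (splits p (down (suc m)))) (applyUpTo suc (length (down m)))
    ≡⟨ cong (λ l → sumBy (λ p → splitSum (χ K i k) (χ K k j) (splits p (down (suc m)))) (applyUpTo suc l)) (length-applyDownFrom suc m) ⟩
  sumBy (λ p → splitSum (χ K i k) (χ K k j) (splits p (down (suc m)))) (applyUpTo suc m)
    ≡⟨ sumBy-cong term (applyUpTo suc m) ⟩
  sumBy (λ p → F (suc p)) (applyUpTo suc m)
    ≡⟨ sumBy-map F suc (applyUpTo suc m) ⟨
  sumBy F (map suc (applyUpTo suc m))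
    ≡⟨ cong (sumBy F) (map-applyUpTo suc suc m) ⟩
  sumBy F (applyUpTo (λ t → 2 + t) m)
    ≡⟨ sum-map F (applyUpTo (λ t → 2 + t) m) ⟨
  sumFrom2 (suc (suc m)) F ∎
  where
    open ≡-Reasoning
    K = suc k
    F : ℕ → ℕ
    F t = ((suc m) C (t ∸ 1)) * B K i k (t ∸ 1) * B K k j (suc (suc m) ∸ t)
    term : ∀ p → splitSum (χ K i k) (χ K k j) (splits p (down (suc m))) ≡ F (suc p)
    term p = begin
      splitSum (χ K i k) (χ K k j) (splits p (down (suc m)))
        ≡⟨ splitSum-relabel (λ d → indicator (goodRuns K i k (runsOf d))) (λ d → indicator (goodRuns K k j (runsOf d))) p (down (suc m)) (down-decreasing (suc m)) ⟩
      (length (down (suc m)) C p) * (sumBy (χ K i k) (arrangements (down p)) * sumBy (χ K k j) (arrangements (down (length (down (suc m)) ∸ p))))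
        ≡⟨ cong (λ l → (l C p) * (sumBy (χ K i k) (arrangements (down p)) * sumBy (χ K k j) (arrangements (down (l ∸ p))))) (length-applyDownFrom suc (suc m)) ⟩
      (suc m C p) * (sumBy (χ K i k) (arrangements (down p)) * sumBy (χ K k j) (arrangements (down (suc m ∸ p))))
        ≡⟨ cong₂ (λ a b → (suc m C p) * (a * b)) (B-arrangements K i k p) (B-arrangements K k j (suc m ∸ p)) ⟨
      (suc m C p) * (B K i k p * B K k j (suc m ∸ p))
        ≡⟨ *-assoc (suc m C p) _ _ ⟨
      F (suc p) ∎

mainTheorem2 : (k : ℕ) → 1 ≤ k → (n i j : ℕ) → 1 < n →
    1 ≤ i → i ≤ k → 1 ≤ j → j ≤ k →
    B k i j n ≡ B k (i ∸ 1) j (n ∸ 1) + B k i (j ∸ 1) (n ∸ 1)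
      + sumFrom2 n (λ t → ((n ∸ 1) C (t ∸ 1)) * B k i (k ∸ 1) (t ∸ 1) * B k (k ∸ 1) j (n ∸ t))
mainTheorem2 (suc k) _ (suc zero) i j (s≤s ()) _ _ _ _
mainTheorem2 (suc k) _ (suc (suc m)) i j _ _ i≤k _ j≤k = begin
  B K i j n
    ≡⟨ B-arrangements K i j n ⟩
  sumBy (χ K i j) (arrangements (n ∷ suc m ∷ down m))
    ≡⟨ arrangements-insertMax k i j n (suc m) (down m) i≤k j≤k (All.map s≤s (down-bounded (suc m))) ⟩
  maxFirst + (maxInside + maxLast)
    ≡⟨ cong₂ _+_ (sym (B-arrangements K (i ∸ 1) j (suc m)))
                 (cong₂ _+_ (convolution k i j m) (sym (B-arrangements K i (j ∸ 1) (suc m)))) ⟩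
  B K (i ∸ 1) j (suc m) + (conv + B K i (j ∸ 1) (suc m))
    ≡⟨ cong (B K (i ∸ 1) j (suc m) +_) (+-comm conv (B K i (j ∸ 1) (suc m))) ⟩
  B K (i ∸ 1) j (suc m) + (B K i (j ∸ 1) (suc m) + conv)
    ≡⟨ +-assoc (B K (i ∸ 1) j (suc m)) _ conv ⟨
  B K (i ∸ 1) j (suc m) + B K i (j ∸ 1) (suc m) + conv ∎
  where
    open ≡-Reasoning
    K = suc k
    n = suc (suc m)
    maxFirst = sumBy (χ K (i ∸ 1) j) (arrangements (down (suc m)))
    maxInside = sumBy (λ p → splitSum (χ K i k) (χ K k j) (splits p (down (suc m)))) (applyUpTo suc (length (down m)))
    maxLast = sumBy (χ K i (j ∸ 1)) (arrangements (down (suc m)))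
    conv = sumFrom2 n (λ t → ((n ∸ 1) C (t ∸ 1)) * B K i k (t ∸ 1) * B K k j (n ∸ t))
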